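{- Let $\mathcal S=\{p^k : p \text{ prime}, k\in\mathbb N, k\neq 0\}$. For each $n\in\mathcal S$ let $\mathbb F_n=GF(n)$ and let $\sigma_n$ be a primitive $(n-1)$-th root of unity in $\mathbb F_n$ (a generator of $\mathbb F_n^*$). If there is a family of boolean circuits computing $\mathrm{FFFT}_{n-1,\sigma_n}$ over $\mathbb F_n$ of size $O(n\log n)$ and depth $O(\log n)$ (each input and output field element represented by $\log|\mathbb F_n|$ bits), then for every $\varepsilon>0$ there is a family of non-adaptive data structures $\{\mathcal D_n\}_{n\in\mathcal S}$ where $\mathcal D_n$ uses advice of size $O(n\log n/\log\log n)$ and, on a query $j\in[n-1]$, outputs the $j$-th output of $\mathrm{FFFT}_{n-1,\sigma_n}$ using $O(n^{\varepsilon})$ queries to the input.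
   Context: For a finite field $\mathbb F$, $m$ dividing $|\mathbb F|-1$ and $\sigma\in\mathbb F$ of multiplicative order $m$, the Finite Field Fourier transform is $\mathrm{FFFT}_{m,\sigma}:\mathbb F^m\to\mathbb F^m$, $(\alpha_0,\dots,\alpha_{m-1})\mapsto(\beta_0,\dots,\beta_{m-1})$ with $\beta_i=\sum_{j\in[m]}\alpha_j\sigma^{ij}$, where $[m]=\{0,\dots,m-1\}$. Circuits have constant fan-in gates. A non-adaptive (systematic, non-uniform) data structure consists of a preprocessing algorithm computing an advice string from the input $(\alpha_0,\dots,\alpha_{n-2})$, and a query algorithm that on a query $j$ has full access to the advice and reads some input entries $\alpha_i$, where the set of entries read depends only on $j$; the algorithms may depend on $n$. -}

module Defs where

open import Level using (0ℓ)
open import Data.Bool using (Bool; false)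
open import Data.Nat using (ℕ; zero; suc; _+_; _*_; _∸_; _^_; _≤_; _<_; NonZero; _⊔_)
open import Data.Nat.Primality using (Prime)
open import Data.Nat.Logarithm using (⌈log₂_⌉)
open import Data.Fin using (Fin; toℕ)
import Data.Fin as Fin
open import Data.List using (List; []; _∷_; _++_; [_]; map; length; concat; replicate; allFin)
open import Data.Vec using (Vec; toList)
open import Data.Product using (Σ; ∃; _×_; _,_)
open import Function.Bundles using (_↔_)
open import Function.Definitions using (Injective)
open import Relation.Binary.PropositionalEquality using (_≡_)
open import Relation.Nullary using (¬_)
open import Algebra.Structures using (IsCommutativeRing)

IsPrimePower : ℕ → Set
IsPrimePower n = Σ ℕ λ p → Σ ℕ λ k → Prime p × NonZero k × n ≡ p ^ k

S : Set
S = Σ ℕ IsPrimePower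

num : S → ℕ
num (n , _) = n

record FiniteField (n : ℕ) : Set₁ where
  field
    Carrier : Set
    _+F_ _*F_ : Carrier → Carrier → Carrier
    -F_ : Carrier → Carrier
    0F 1F : Carrier
    isCommutativeRing : IsCommutativeRing _≡_ _+F_ _*F_ -F_ 0F 1F
    0≢1 : ¬ (0F ≡ 1F)
    inverse : ∀ x → ¬ (x ≡ 0F) → Σ Carrier λ y → x *F y ≡ 1F
    size : Carrier ↔ Fin n

  _^F_ : Carrier → ℕ → Carrier
  x ^F zero  = 1F
  x ^F suc k = x *F (x ^F k)

  ΣF : (m : ℕ) → (Fin m → Carrier) → Carrier
  ΣF zero    f = 0F
  ΣF (suc m) f = f Fin.zero +F ΣF m (λ j → f (Fin.suc j))

  HasOrder : Carrier → ℕ → Set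
  HasOrder σ m = NonZero m × σ ^F m ≡ 1F × (∀ k → 0 < k → k < m → ¬ (σ ^F k ≡ 1F))

  FFFT : (m : ℕ) → Carrier → (Fin m → Carrier) → Fin m → Carrier
  FFFT m σ α i = ΣF m (λ j → α j *F (σ ^F (toℕ i * toℕ j)))

-- Wires are numbered: wires
-- 0 … I-1 are the inputs, wire I+k is the output of the k-th gate.
-- A gate reading a wire that does not exist yet reads the constant
-- false (so it just acts as a constant); likewise for outputs.

record Gate : Set where
  field
    fn      : Bool → Bool → Bool
    inL inR : ℕ

record Circuit : Set where
  field
    gates   : List Gate
    outputs : List ℕ

at : {A : Set} → A → List A → ℕ → A
at d []       _       = d
at d (x ∷ xs) zero    = x
at d (x ∷ xs) (suc i) = at d xs i

wireValues : List Gate → List Bool → List Bool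
wireValues []       vs = vs
wireValues (g ∷ gs) vs =
  wireValues gs (vs ++ [ Gate.fn g (at false vs (Gate.inL g)) (at false vs (Gate.inR g)) ])

wireDepths : List Gate → List ℕ → List ℕ
wireDepths []       ds = ds
wireDepths (g ∷ gs) ds =
  wireDepths gs (ds ++ [ suc (at 0 ds (Gate.inL g) ⊔ at 0 ds (Gate.inR g)) ])

run : Circuit → List Bool → List Bool
run C xs = map (at false (wireValues (Circuit.gates C) xs)) (Circuit.outputs C)

size : Circuit → ℕ
size C = length (Circuit.gates C)

DepthAtMost : Circuit → (I : ℕ) → ℕ → Set
DepthAtMost C I d =
  ∀ w → at 0 (wireDepths (Circuit.gates C) (replicate I 0)) w ≤ d

module _ {n : ℕ} (F : FiniteField n) where
  open FiniteField F

  Encoding : Set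
  Encoding = Σ (Carrier → Vec Bool ⌈log₂ n ⌉) λ enc → Injective _≡_ _≡_ enc

  encodeAll : (Carrier → Vec Bool ⌈log₂ n ⌉) → (m : ℕ) → (Fin m → Carrier) → List Bool
  encodeAll enc m α = concat (map (λ j → toList (enc (α j))) (allFin m))

  Computes : Circuit → (Carrier → Vec Bool ⌈log₂ n ⌉) → Carrier → Set
  Computes C enc σ =
    ∀ (α : Fin (n ∸ 1) → Carrier) →
      run C (encodeAll enc (n ∸ 1) α) ≡ encodeAll enc (n ∸ 1) (FFFT (n ∸ 1) σ α)

  -- Non-adaptive (systematic, non-uniform) data structures for
  -- FFFT_{n-1,σ}: the input is α = (α_0,…,α_{n-2}); preprocessing
  -- produces an advice string of advSize bits; on query j the query
  -- algorithm reads the input entries at the positions listed in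
  -- (queries j) (depending only on j), and answers from the advice and
  -- the values read.

  record DataStructure (σ : Carrier) : Set where
    field
      advSize    : ℕ
      preprocess : (Fin (n ∸ 1) → Carrier) → Vec Bool advSize
      queries    : Fin (n ∸ 1) → List (Fin (n ∸ 1))
      answer     : (j : Fin (n ∸ 1)) → Vec Bool advSize → List Carrier → Carrier
      correct    : ∀ (α : Fin (n ∸ 1) → Carrier) (j : Fin (n ∸ 1)) →
                     answer j (preprocess α) (map α (queries j)) ≡ FFFT (n ∸ 1) σ α j

-- Valiant's depth reduction. Label every wire by its depth d < 2 ^ B in the circuit
-- (B ≈ log log n) and every edge u → w by the most significant bit in which the labels
-- of u and w differ. Split the B bit positions into ⌊B / r⌋ windows of r consecutive bits
-- and cut the edges of the window that contains fewest of them: at most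
-- 2 size / ⌊B / r⌋ = O(n log n / log log n) edges. The advice stores the values carried
-- by the cut edges. Along an uncut edge the depth labels, restricted to the B − r kept
-- bits, strictly increase, so an output bit depends through uncut edges on at most
-- 2 ^ 2 ^ (B − r) ≤ n ^ (1 / 2b) input bits; the query algorithm reads those inputs and
-- re-evaluates the output from them and the advice.
module Submission where

open import Defs
open import Data.Nat using (ℕ; _+_; _*_; _∸_; _^_; _≤_; NonZero)
open import Data.Nat.Logarithm using (⌊log₂_⌋; ⌈log₂_⌉)
open import Data.Product using (Σ; _×_; proj₁)
open import Data.List using (length)

open import Data.Bool using (Bool; true; false; not; _∧_; if_then_else_; T)
import Data.Bool as Bool
open import Data.Bool.Properties using (T-≡; T-∧)
open import Data.Nat
open import Data.Nat.Properties
open import Data.Nat.DivMod using (_/_; _%_; m≡m%n+[m/n]*n; m%n<n; m/n*n≤m; m<n*o⇒m/o<n; m≥n⇒m/n>0)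
open import Data.Nat.Logarithm
open import Data.Nat.Solver using (module +-*-Solver)
open import Data.Fin using (Fin; toℕ; fromℕ<)
import Data.Fin as Fin
open import Data.Fin.Properties using (toℕ-fromℕ<; toℕ-injective; toℕ<n)
open import Data.List using (List; []; _∷_; _++_; [_]; map; concat; tabulate; allFin; replicate; filterᵇ; mapMaybe; concatMap; upTo)
open import Data.List.Properties using (length-++; ++-assoc; ++-identityʳ; map-tabulate; length-replicate; length-filter; length-mapMaybe; length-applyUpTo)
open import Data.List.Membership.Propositional using (_∈_)
open import Data.List.Membership.Propositional.Properties using (∈-++⁻; ∈-filter⁺; ∈-map⁺; ∈-allFin; ∈-concatMap⁺; ∈-concatMap⁻; ∈-upTo⁺)
open import Data.List.Relation.Unary.All using (All; []; _∷_)
import Data.List.Relation.Unary.All as All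
open import Data.List.Relation.Unary.All.Properties using (++⁻ˡ; ++⁻ʳ)
open import Data.List.Relation.Unary.Any using (here; there)
import Data.List.Relation.Unary.Any as Any
open import Data.Maybe using (Maybe; just; nothing)
open import Data.Vec using (Vec; toList; fromList; lookup)
import Data.Vec as Vec
import Data.Vec.Properties as Vecₚ
open import Data.Product using (Σ; _×_; _,_; proj₁; proj₂; uncurry)
open import Data.Sum using (inj₁; inj₂)
import Data.Sum as Sum
open import Data.Unit using (tt)
open import Function using (_∘_; id)
open import Function.Bundles using (Equivalence; Inverse; _↔_)
open import Function.Definitions using (Injective)
open import Relation.Binary.Definitions using (DecidableEquality)
open import Relation.Nullary using (yes; no; contradiction)
open import Relation.Nullary.Decidable using (T?)
open import Relation.Nullary.Reflects using (ofʸ; ofⁿ)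
open import Relation.Binary.PropositionalEquality hiding ([_])

n<2^n : ∀ n → n < 2 ^ n
n<2^n zero    = s≤s z≤n
n<2^n (suc n) = +-mono-≤-< (m^n>0 2 n) (<-≤-trans (n<2^n n) (m≤m+n (2 ^ n) 0))

n<2^m⇒⌊log₂n⌋<m : ∀ m {n} → 1 ≤ n → n < 2 ^ m → ⌊log₂ n ⌋ < m
n<2^m⇒⌊log₂n⌋<m zero    1≤n n<1 = contradiction 1≤n (<⇒≱ n<1)
n<2^m⇒⌊log₂n⌋<m (suc m) {suc zero}        _ _ = s≤s z≤n
n<2^m⇒⌊log₂n⌋<m (suc m) {n@(suc (suc _))} _ n<2^1+m = begin-strict
  ⌊log₂ n ⌋                 ≤⟨ m≤n+m∸n ⌊log₂ n ⌋ 1 ⟩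
  suc (⌊log₂ n ⌋ ∸ 1)       ≡⟨ cong suc (⌊log₂⌊n/2⌋⌋≡⌊log₂n⌋∸1 n) ⟨
  suc ⌊log₂ ⌊ n /2⌋ ⌋       <⟨ s≤s (n<2^m⇒⌊log₂n⌋<m m (s≤s z≤n) half<2^m) ⟩
  suc m                     ∎
  where
  open ≤-Reasoning
  half+half≤n : ⌊ n /2⌋ + ⌊ n /2⌋ ≤ n
  half+half≤n = subst (⌊ n /2⌋ + ⌊ n /2⌋ ≤_) (⌊n/2⌋+⌈n/2⌉≡n n) (+-monoʳ-≤ ⌊ n /2⌋ (⌊n/2⌋≤⌈n/2⌉ n))
  half<2^m : ⌊ n /2⌋ < 2 ^ m
  half<2^m = ≰⇒> λ 2^m≤half → <⇒≱ (≤-<-trans half+half≤n n<2^1+m)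
               (subst (_≤ ⌊ n /2⌋ + ⌊ n /2⌋) (cong (2 ^ m +_) (sym (+-identityʳ (2 ^ m)))) (+-mono-≤ 2^m≤half 2^m≤half))

2^⌊log₂n⌋≤n : ∀ n → 1 ≤ n → 2 ^ ⌊log₂ n ⌋ ≤ n
2^⌊log₂n⌋≤n n 1≤n = ≮⇒≥ λ n<2^ → <-irrefl refl (n<2^m⇒⌊log₂n⌋<m ⌊log₂ n ⌋ 1≤n n<2^)

n<2^[1+⌊log₂n⌋] : ∀ n → n < 2 ^ suc ⌊log₂ n ⌋
n<2^[1+⌊log₂n⌋] n = ≰⇒> λ 2^≤n →
  <-irrefl refl (subst (_≤ ⌊log₂ n ⌋) (⌊log₂[2^n]⌋≡n _) (⌊log₂⌋-mono-≤ 2^≤n))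

⌈log₂n⌉≤1+⌊log₂n⌋ : ∀ n → ⌈log₂ n ⌉ ≤ suc ⌊log₂ n ⌋
⌈log₂n⌉≤1+⌊log₂n⌋ n =
  subst (⌈log₂ n ⌉ ≤_) (⌈log₂2^n⌉≡n _) (⌈log₂⌉-mono-≤ (<⇒≤ (n<2^[1+⌊log₂n⌋] n)))

^-distribʳ-* : ∀ m n o → (m * n) ^ o ≡ m ^ o * n ^ o
^-distribʳ-* m n zero    = refl
^-distribʳ-* m n (suc o) = begin
  m * n * (m * n) ^ o       ≡⟨ cong (m * n *_) (^-distribʳ-* m n o) ⟩
  m * n * (m ^ o * n ^ o)   ≡⟨ solve 4 (λ m n x y → m :* n :* (x :* y) := m :* x :* (n :* y)) refl m n (m ^ o) (n ^ o) ⟩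
  m * m ^ o * (n * n ^ o)   ∎
  where
  open ≡-Reasoning
  open +-*-Solver

m*m≤n*n⇒m≤n : ∀ m n → m * m ≤ n * n → m ≤ n
m*m≤n*n⇒m≤n m n m²≤n² = ≮⇒≥ λ n<m → <⇒≱ (*-mono-< n<m n<m) m²≤n²

[1+k]^p≤p^p*2^k : ∀ p k .{{_ : NonZero p}} → suc k ^ p ≤ p ^ p * 2 ^ k
[1+k]^p≤p^p*2^k p k = begin
  suc k ^ p              ≤⟨ ^-monoˡ-≤ p 1+k≤p*2^q ⟩
  (p * 2 ^ q) ^ p        ≡⟨ ^-distribʳ-* p (2 ^ q) p ⟩
  p ^ p * (2 ^ q) ^ p    ≡⟨ cong (p ^ p *_) (^-*-assoc 2 q p) ⟩
  p ^ p * 2 ^ (q * p)    ≤⟨ *-monoʳ-≤ (p ^ p) (^-monoʳ-≤ 2 (m/n*n≤m k p)) ⟩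
  p ^ p * 2 ^ k          ∎
  where
  open ≤-Reasoning
  q : ℕ
  q = k / p
  1+k≤p*2^q : suc k ≤ p * 2 ^ q
  1+k≤p*2^q = begin
    suc k                  ≡⟨ cong suc (m≡m%n+[m/n]*n k p) ⟩
    suc (k % p + q * p)    ≤⟨ +-monoˡ-≤ (q * p) (m%n<n k p) ⟩
    suc q * p              ≡⟨ *-comm (suc q) p ⟩
    p * suc q              ≤⟨ *-monoʳ-≤ p (n<2^n q) ⟩
    p * 2 ^ q              ∎

2*m≤o⇒2*n≤o⇒m+n≤o : ∀ m n {o} → 2 * m ≤ o → 2 * n ≤ o → m + n ≤ o
2*m≤o⇒2*n≤o⇒m+n≤o m n {o} 2m≤o 2n≤o = begin
  m + n                    ≤⟨ +-mono-≤ (m≤m⊔n m n) (m≤n⊔m m n) ⟩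
  (m ⊔ n) + (m ⊔ n)        ≡⟨ cong ((m ⊔ n) +_) (+-identityʳ (m ⊔ n)) ⟨
  2 * (m ⊔ n)              ≡⟨ *-distribˡ-⊔ 2 m n ⟩
  2 * m ⊔ 2 * n            ≤⟨ ⊔-lub 2m≤o 2n≤o ⟩
  o                        ∎
  where
  open ≤-Reasoning

module _ {A : Set} (d : A) where

  at-++ˡ : ∀ xs ys {i} → i < length xs → at d (xs ++ ys) i ≡ at d xs i
  at-++ˡ (x ∷ xs) ys {zero}  _         = refl
  at-++ˡ (x ∷ xs) ys {suc i} (s≤s i<) = at-++ˡ xs ys i<

  at-++ʳ : ∀ xs ys i → at d (xs ++ ys) (length xs + i) ≡ at d ys i
  at-++ʳ []       ys i = refl
  at-++ʳ (x ∷ xs) ys i = at-++ʳ xs ys i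

  at-length : ∀ xs y ys → at d (xs ++ y ∷ ys) (length xs) ≡ y
  at-length []       y ys = refl
  at-length (x ∷ xs) y ys = at-length xs y ys

  at-≥length : ∀ xs {i} → length xs ≤ i → at d xs i ≡ d
  at-≥length []       _         = refl
  at-≥length (x ∷ xs) (s≤s le) = at-≥length xs le

  at-map : ∀ {B : Set} {e : B} (f : A → B) → f d ≡ e → ∀ xs i → at e (map f xs) i ≡ f (at d xs i)
  at-map f fd≡e []       i       = sym fd≡e
  at-map f fd≡e (x ∷ xs) zero    = refl
  at-map f fd≡e (x ∷ xs) (suc i) = at-map f fd≡e xs i

readBelow : {A : Set} → A → (ℕ → A) → ℕ → ℕ → A
readBelow d val w u with u <? w
... | yes _ = val u
... | no  _ = d

readBelow-< : ∀ {A : Set} (d : A) (f : ℕ → A) {w u} → u < w → readBelow d f w u ≡ f u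
readBelow-< d f {w} {u} u<w with u <? w
... | yes _   = refl
... | no  u≮w = contradiction u<w u≮w

at-prefix : ∀ {A : Set} (d : A) xs ys u → at d xs u ≡ readBelow d (at d (xs ++ ys)) (length xs) u
at-prefix d xs ys u with u <? length xs
... | yes u< = sym (at-++ˡ d xs ys u<)
... | no  u≮ = at-≥length d xs (≮⇒≥ u≮)

noGate : Gate
noGate = record { fn = λ _ _ → false ; inL = 0 ; inR = 0 }

gateAt : List Gate → ℕ → Gate
gateAt = at noGate

module Wires {A : Set} (d : A) (h : Gate → A → A → A) where

  gateOutput : Gate → List A → A
  gateOutput g vs = h g (at d vs (Gate.inL g)) (at d vs (Gate.inR g))

  evalWires : List Gate → List A → List A
  evalWires []       vs = vs
  evalWires (g ∷ gs) vs = evalWires gs (vs ++ [ gateOutput g vs ])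

  evalWires-extends : ∀ gs vs → Σ (List A) λ ys → evalWires gs vs ≡ vs ++ ys
  evalWires-extends []       vs = [] , sym (++-identityʳ vs)
  evalWires-extends (g ∷ gs) vs with evalWires-extends gs (vs ++ [ gateOutput g vs ])
  ... | ys , eq = gateOutput g vs ∷ ys , trans eq (++-assoc vs [ gateOutput g vs ] ys)

  length-evalWires : ∀ gs vs → length (evalWires gs vs) ≡ length vs + length gs
  length-evalWires []       vs = sym (+-identityʳ (length vs))
  length-evalWires (g ∷ gs) vs = begin
    length (evalWires gs (vs ++ [ gateOutput g vs ]))   ≡⟨ length-evalWires gs (vs ++ [ gateOutput g vs ]) ⟩
    length (vs ++ [ gateOutput g vs ]) + length gs      ≡⟨ cong (_+ length gs) (length-++ vs) ⟩
    length vs + 1 + length gs                           ≡⟨ +-assoc (length vs) 1 (length gs) ⟩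
    length vs + suc (length gs)                         ∎
    where
    open ≡-Reasoning

  evalWires-prefix : ∀ gs vs {u} → u < length vs → at d (evalWires gs vs) u ≡ at d vs u
  evalWires-prefix gs vs u< with evalWires-extends gs vs
  ... | ys , eq rewrite eq = at-++ˡ d vs ys u<

  evalWires-absent : ∀ gs vs {w} → length vs + length gs ≤ w → at d (evalWires gs vs) w ≡ d
  evalWires-absent gs vs le = at-≥length d (evalWires gs vs) (subst (_≤ _) (sym (length-evalWires gs vs)) le)

  Follows : ℕ → List Gate → (ℕ → A) → Set
  Follows I G val = ∀ k → k < length G →
    let g = gateAt G k in
    val (I + k) ≡ h g (readBelow d val (I + k) (Gate.inL g)) (readBelow d val (I + k) (Gate.inR g))

  evalWires-follows : ∀ gs vs → Follows (length vs) gs (at d (evalWires gs vs))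
  evalWires-follows (g ∷ gs) vs zero _ with evalWires-extends gs (vs ++ [ gateOutput g vs ])
  ... | ys , eq rewrite eq | ++-assoc vs [ gateOutput g vs ] ys | +-identityʳ (length vs) =
    trans (at-length d vs _ ys) (cong₂ (h g) (at-prefix d vs _ (Gate.inL g)) (at-prefix d vs _ (Gate.inR g)))
  evalWires-follows (g ∷ gs) vs (suc k) (s≤s k<) =
    subst (λ w → let W = at d (evalWires gs vs′) ; g′ = gateAt gs k in
                 W w ≡ h g′ (readBelow d W w (Gate.inL g′)) (readBelow d W w (Gate.inR g′)))
          shift (evalWires-follows gs vs′ k k<)
    where
    vs′ : List A
    vs′ = vs ++ [ gateOutput g vs ]
    shift : length vs′ + k ≡ length vs + suc k
    shift = trans (cong (_+ k) (trans (length-++ vs) (+-comm (length vs) 1))) (sym (+-suc (length vs) k))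

wireValues≡evalWires : ∀ gs vs → wireValues gs vs ≡ Wires.evalWires false Gate.fn gs vs
wireValues≡evalWires []       vs = refl
wireValues≡evalWires (g ∷ gs) vs = wireValues≡evalWires gs _

wireDepths≡evalWires : ∀ gs ds → wireDepths gs ds ≡ Wires.evalWires 0 (λ _ a b → suc (a ⊔ b)) gs ds
wireDepths≡evalWires []       ds = refl
wireDepths≡evalWires (g ∷ gs) ds = wireDepths≡evalWires gs _

module Values = Wires false Gate.fn
module Depths = Wires 0 (λ _ a b → suc (a ⊔ b))

module CircuitGraph (I : ℕ) (G : List Gate) where

  data WireKind : ℕ → Set where
    input  : ∀ {w} → w < I → WireKind w
    gate   : ∀ k → k < length G → WireKind (I + k)
    absent : ∀ {w} → I + length G ≤ w → WireKind w

  wireKind : ∀ w → WireKind w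
  wireKind w with w <? I
  ... | yes w<I = input w<I
  ... | no  w≮I with w ∸ I <? length G
  ...   | yes k< = subst WireKind (m+[n∸m]≡n (≮⇒≥ w≮I)) (gate (w ∸ I) k<)
  ...   | no  k≮ = absent (subst (I + length G ≤_) (m+[n∸m]≡n (≮⇒≥ w≮I)) (+-monoʳ-≤ I (≮⇒≥ k≮)))

  data Edge : ℕ → ℕ → Set where
    left  : ∀ {k} → k < length G → Gate.inL (gateAt G k) < I + k → Edge (Gate.inL (gateAt G k)) (I + k)
    right : ∀ {k} → k < length G → Gate.inR (gateAt G k) < I + k → Edge (Gate.inR (gateAt G k)) (I + k)

  -- Every gate contributes its two input pairs, including the (harmless) pairs that are not edges.
  edgesFrom : ℕ → List Gate → List (ℕ × ℕ)
  edgesFrom w []       = []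
  edgesFrom w (g ∷ gs) = (Gate.inL g , w) ∷ (Gate.inR g , w) ∷ edgesFrom (suc w) gs

  length-edgesFrom : ∀ w gs → length (edgesFrom w gs) ≡ length gs * 2
  length-edgesFrom w []       = refl
  length-edgesFrom w (g ∷ gs) = cong (2 +_) (length-edgesFrom (suc w) gs)

  inputs∈edgesFrom : ∀ w gs {k} → k < length gs →
    (Gate.inL (gateAt gs k) , w + k) ∈ edgesFrom w gs × (Gate.inR (gateAt gs k) , w + k) ∈ edgesFrom w gs
  inputs∈edgesFrom w (g ∷ gs) {zero} _ rewrite +-identityʳ w = here refl , there (here refl)
  inputs∈edgesFrom w (g ∷ gs) {suc k} (s≤s k<) rewrite +-suc w k with inputs∈edgesFrom (suc w) gs k<
  ... | l∈ , r∈ = there (there l∈) , there (there r∈)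

  edge∈edges : ∀ {u w} → Edge u w → (u , w) ∈ edgesFrom I G
  edge∈edges (left  k< _) = proj₁ (inputs∈edgesFrom I G k<)
  edge∈edges (right k< _) = proj₂ (inputs∈edgesFrom I G k<)

  module Cutting (cut : ℕ → ℕ → Bool) where

    cutEdges : List (ℕ × ℕ)
    cutEdges = filterᵇ (uncurry cut) (edgesFrom I G)

    edge∈cutEdges : ∀ {u w} → Edge u w → cut u w ≡ true → (u , w) ∈ cutEdges
    edge∈cutEdges e cut≡true = ∈-filter⁺ (λ e → T? (uncurry cut e)) (edge∈edges e) (subst T (sym cut≡true) tt)

    evalWithAdvice : (inp adv : ℕ → Bool) → ℕ → ℕ → Bool
    evalAlong : (inp adv : ℕ → Bool) → ℕ → ℕ → ℕ → Bool

    evalWithAdvice inp adv zero    w = false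
    evalWithAdvice inp adv (suc f) w with wireKind w
    ... | input _  = inp w
    ... | absent _ = false
    ... | gate k _ = Gate.fn (gateAt G k) (evalAlong inp adv f (I + k) (Gate.inL (gateAt G k)))
                                          (evalAlong inp adv f (I + k) (Gate.inR (gateAt G k)))

    evalAlong inp adv f w = readBelow false (λ u → if cut u w then adv u else evalWithAdvice inp adv f u) w

    -- the input wires read by evalWithAdvice inp adv f w
    reach : ℕ → ℕ → List ℕ
    reachAlong : ℕ → ℕ → ℕ → List ℕ

    reach zero    w = []
    reach (suc f) w with wireKind w
    ... | input _  = [ w ]
    ... | absent _ = []
    ... | gate k _ = reachAlong f (I + k) (Gate.inL (gateAt G k)) ++ reachAlong f (I + k) (Gate.inR (gateAt G k))

    reachAlong f w = readBelow [] (λ u → if cut u w then [] else reach f u) w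

    reach-inputs : ∀ f w {u} → u ∈ reach f w → u < I
    reachAlong-inputs : ∀ f w v {u} → u ∈ reachAlong f w v → u < I

    reach-inputs (suc f) w u∈ with wireKind w
    reach-inputs (suc f) w (here refl) | input w<I = w<I
    ... | gate k _ with ∈-++⁻ (reachAlong f (I + k) (Gate.inL (gateAt G k))) u∈
    ...   | inj₁ u∈ˡ = reachAlong-inputs f (I + k) _ u∈ˡ
    ...   | inj₂ u∈ʳ = reachAlong-inputs f (I + k) _ u∈ʳ

    reachAlong-inputs f w v u∈ with v <? w
    ... | yes _ with cut v w
    ...   | false = reach-inputs f v u∈

    module _ (val : ℕ → Bool) (follows : Values.Follows I G val)
             (absent-false : ∀ {w} → I + length G ≤ w → val w ≡ false)
             (inp adv : ℕ → Bool) (adv-correct : ∀ {u w} → Edge u w → cut u w ≡ true → adv u ≡ val u)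
             where

      evalWithAdvice-correct : ∀ f w → w < f → All (λ u → inp u ≡ val u) (reach f w) →
                               evalWithAdvice inp adv f w ≡ val w
      evalAlong-correct : ∀ f w v → (v < w → Edge v w) → w ≤ f → All (λ u → inp u ≡ val u) (reachAlong f w v) →
                          evalAlong inp adv f w v ≡ readBelow false val w v

      evalWithAdvice-correct (suc f) w (s≤s w≤f) inp≡val with wireKind w
      evalWithAdvice-correct (suc f) w (s≤s w≤f) (inp≡val ∷ []) | input _ = inp≡val
      ... | absent le = sym (absent-false le)
      ... | gate k k< = trans
        (cong₂ (Gate.fn (gateAt G k)) (evalAlong-correct f _ _ (left k<)  w≤f (++⁻ˡ _ inp≡val))
                                      (evalAlong-correct f _ _ (right k<) w≤f (++⁻ʳ _ inp≡val)))
        (sym (follows k k<))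

      evalAlong-correct f w v edge w≤f inp≡val with v <? w
      ... | no  _   = refl
      ... | yes v<w with cut v w in cut≡
      ...   | true  = adv-correct (edge v<w) cut≡
      ...   | false = evalWithAdvice-correct f v (<-≤-trans v<w w≤f) inp≡val

    module _ (pot : ℕ → ℕ) (pot-increases : ∀ {u w} → Edge u w → cut u w ≡ false → pot u < pot w) where

      length-reach : ∀ f w → length (reach f w) ≤ 2 ^ pot w
      length-reachAlong : ∀ f w v → (v < w → Edge v w) → 2 * length (reachAlong f w v) ≤ 2 ^ pot w

      length-reach zero    w = z≤n
      length-reach (suc f) w with wireKind w
      ... | input _  = m^n>0 2 (pot w)
      ... | absent _ = z≤n
      ... | gate k k< = subst (_≤ 2 ^ pot (I + k)) (sym (length-++ reachˡ))
        (2*m≤o⇒2*n≤o⇒m+n≤o (length reachˡ) (length reachʳ)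
          (length-reachAlong f _ _ (left k<)) (length-reachAlong f _ _ (right k<)))
        where
        reachˡ reachʳ : List ℕ
        reachˡ = reachAlong f (I + k) (Gate.inL (gateAt G k))
        reachʳ = reachAlong f (I + k) (Gate.inR (gateAt G k))

      length-reachAlong f w v edge with v <? w
      ... | no  _   = z≤n
      ... | yes v<w with cut v w in cut≡
      ...   | true  = z≤n
      ...   | false = ≤-trans (*-monoʳ-≤ 2 (length-reach f v)) (^-monoʳ-≤ 2 (pot-increases (edge v<w) cut≡))

indicator : Bool → ℕ
indicator true  = 1
indicator false = 0

indicator≤1 : ∀ b → indicator b ≤ 1
indicator≤1 true  = ≤-refl
indicator≤1 false = z≤n

count : ℕ → (ℕ → Bool) → ℕ
count zero    keep = 0
count (suc B) keep = indicator (keep 0) + count B (keep ∘ suc)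

-- Bits of a number x < 2 ^ B are indexed from the most significant one, which has position 0.
-- keptBits B keep x is the number formed by the bits of x at the positions selected by keep.
keptBits : ℕ → (ℕ → Bool) → ℕ → ℕ
keptBits zero    keep x = 0
keptBits (suc B) keep x with x <? 2 ^ B
... | yes _ = keptBits B (keep ∘ suc) x
... | no  _ = (if keep 0 then 2 ^ count B (keep ∘ suc) else 0) + keptBits B (keep ∘ suc) (x ∸ 2 ^ B)

-- the position of the most significant bit in which x and y differ
firstDiff : ℕ → ℕ → ℕ → ℕ
firstDiff zero    x y = 0
firstDiff (suc B) x y with x <? 2 ^ B | y <? 2 ^ B
... | yes _ | yes _ = suc (firstDiff B x y)
... | no  _ | no  _ = suc (firstDiff B (x ∸ 2 ^ B) (y ∸ 2 ^ B))
... | _     | _     = 0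

keptBits<2^count : ∀ B keep x → keptBits B keep x < 2 ^ count B keep
keptBits<2^count zero    keep x = s≤s z≤n
keptBits<2^count (suc B) keep x with x <? 2 ^ B
... | yes _ = <-≤-trans (keptBits<2^count B (keep ∘ suc) x) (^-monoʳ-≤ 2 (m≤n+m _ (indicator (keep 0))))
... | no  _ with keep 0
...   | false = keptBits<2^count B (keep ∘ suc) (x ∸ 2 ^ B)
...   | true  = begin-strict
  2 ^ c + keptBits B (keep ∘ suc) (x ∸ 2 ^ B)  <⟨ +-monoʳ-< (2 ^ c) (keptBits<2^count B (keep ∘ suc) (x ∸ 2 ^ B)) ⟩
  2 ^ c + 2 ^ c                                ≡⟨ cong (2 ^ c +_) (+-identityʳ (2 ^ c)) ⟨
  2 ^ suc c                                    ∎
  where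
  open ≤-Reasoning
  c : ℕ
  c = count B (keep ∘ suc)

keptBits-increasing : ∀ B keep {x y} → x < y → y < 2 ^ B → keep (firstDiff B x y) ≡ true →
                      keptBits B keep x < keptBits B keep y
keptBits-increasing zero keep {x} x<y (s≤s y≤0) _ = contradiction (<-≤-trans x<y y≤0) λ ()
keptBits-increasing (suc B) keep {x} {y} x<y y<2^B+1 kept with x <? 2 ^ B | y <? 2 ^ B
... | yes _ | yes y<2^B = keptBits-increasing B (keep ∘ suc) x<y y<2^B kept
... | yes _ | no  _ rewrite kept = <-≤-trans (keptBits<2^count B (keep ∘ suc) x) (m≤m+n _ _)
... | no x≮ | yes y< = contradiction (<-trans x<y y<) x≮
... | no x≮ | no y≮ = +-monoʳ-< _ (keptBits-increasing B (keep ∘ suc)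
        (∸-monoˡ-< x<y (≮⇒≥ x≮))
        (subst (y ∸ 2 ^ B <_) (m+n∸m≡n (2 ^ B) (2 ^ B))
               (∸-monoˡ-< (subst (y <_) (cong (2 ^ B +_) (+-identityʳ (2 ^ B))) y<2^B+1) (≮⇒≥ y≮)))
        kept)

count≤ : ∀ B keep → count B keep ≤ B
count≤ zero    keep = z≤n
count≤ (suc B) keep = +-mono-≤ (indicator≤1 (keep 0)) (count≤ B (keep ∘ suc))

count+r≤B : ∀ a r B keep → a + r ≤ B → (∀ p → a ≤ p → p < a + r → keep p ≡ false) → count B keep + r ≤ B
count+r≤B zero zero B keep _ _ = subst (_≤ B) (sym (+-identityʳ _)) (count≤ B keep)
count+r≤B zero (suc r) (suc B) keep (s≤s r≤B) dropped rewrite dropped 0 z≤n (s≤s z≤n) =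
  subst (_≤ suc B) (sym (+-suc (count B (keep ∘ suc)) r))
    (s≤s (count+r≤B zero r B (keep ∘ suc) r≤B λ p _ p<r → dropped (suc p) z≤n (s≤s p<r)))
count+r≤B (suc a) r (suc B) keep (s≤s a+r≤B) dropped = begin
  indicator (keep 0) + count B (keep ∘ suc) + r   ≡⟨ +-assoc (indicator (keep 0)) _ r ⟩
  indicator (keep 0) + (count B (keep ∘ suc) + r) ≤⟨ +-mono-≤ (indicator≤1 (keep 0)) rest ⟩
  suc B                                           ∎
  where
  open ≤-Reasoning
  rest : count B (keep ∘ suc) + r ≤ B
  rest = count+r≤B a r B (keep ∘ suc) a+r≤B λ p a≤p p<a+r → dropped (suc p) (s≤s a≤p) (s≤s p<a+r)

sumTo : ℕ → (ℕ → ℕ) → ℕ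
sumTo zero    f = 0
sumTo (suc g) f = sumTo g f + f g

sumTo-mono-≤ : ∀ g {f h : ℕ → ℕ} → (∀ j → j < g → f j ≤ h j) → sumTo g f ≤ sumTo g h
sumTo-mono-≤ zero    f≤h = z≤n
sumTo-mono-≤ (suc g) f≤h = +-mono-≤ (sumTo-mono-≤ g λ j j<g → f≤h j (m<n⇒m<1+n j<g)) (f≤h g ≤-refl)

sumTo-distrib-+ : ∀ g (f h : ℕ → ℕ) → sumTo g (λ j → f j + h j) ≡ sumTo g f + sumTo g h
sumTo-distrib-+ zero    f h = refl
sumTo-distrib-+ (suc g) f h = begin
  sumTo g (λ j → f j + h j) + (f g + h g)   ≡⟨ cong (_+ (f g + h g)) (sumTo-distrib-+ g f h) ⟩
  sumTo g f + sumTo g h + (f g + h g)       ≡⟨ solve 4 (λ a b x y → a :+ b :+ (x :+ y) := a :+ x :+ (b :+ y)) refl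
                                                         (sumTo g f) (sumTo g h) (f g) (h g) ⟩
  sumTo g f + f g + (sumTo g h + h g)       ∎
  where
  open ≡-Reasoning
  open +-*-Solver

sumTo-const : ∀ g c → sumTo g (λ _ → c) ≡ g * c
sumTo-const zero    c = refl
sumTo-const (suc g) c = trans (cong (_+ c) (sumTo-const g c)) (+-comm (g * c) c)

minimum : ∀ g (f : ℕ → ℕ) → Σ ℕ λ j → j < suc g × (∀ i → i < suc g → f j ≤ f i)
minimum zero    f = 0 , s≤s z≤n , λ { zero _ → ≤-refl ; (suc i) (s≤s ()) }
minimum (suc g) f with minimum g f
... | j , j< , min with f j ≤? f (suc g)
...   | yes fj≤ = j , m<n⇒m<1+n j< , λ i i< → Sum.[ min i , (λ { refl → fj≤ }) ] (m<1+n⇒m<n∨m≡n i<)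
...   | no  fj≰ = suc g , ≤-refl , λ i i< → Sum.[ ≤-trans (<⇒≤ (≰⇒> fj≰)) ∘ min i , (λ { refl → ≤-refl }) ]
                                                (m<1+n⇒m<n∨m≡n i<)

belowAverage : ∀ g (f : ℕ → ℕ) → Σ ℕ λ j → (0 < g → j < g) × g * f j ≤ sumTo g f
belowAverage zero    f = 0 , (λ ()) , z≤n
belowAverage (suc g) f with minimum g f
... | j , j< , min = j , (λ _ → j<) , subst (_≤ sumTo (suc g) f) (sumTo-const (suc g) (f j)) (sumTo-mono-≤ (suc g) min)

length-filterᵇ-∷ : ∀ {A : Set} (keep : A → Bool) x xs →
                   length (filterᵇ keep (x ∷ xs)) ≡ indicator (keep x) + length (filterᵇ keep xs)
length-filterᵇ-∷ keep x xs with keep x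
... | true  = refl
... | false = refl

sumTo-length-filterᵇ : ∀ {A : Set} g (select : ℕ → A → Bool) →
  (∀ x → sumTo g (λ j → indicator (select j x)) ≤ 1) →
  ∀ xs → sumTo g (λ j → length (filterᵇ (select j) xs)) ≤ length xs
sumTo-length-filterᵇ g select once []       = ≤-reflexive (trans (sumTo-const g 0) (*-zeroʳ g))
sumTo-length-filterᵇ g select once (x ∷ xs) = begin
  sumTo g (λ j → length (filterᵇ (select j) (x ∷ xs)))
    ≤⟨ sumTo-mono-≤ g (λ j _ → ≤-reflexive (length-filterᵇ-∷ (select j) x xs)) ⟩
  sumTo g (λ j → indicator (select j x) + length (filterᵇ (select j) xs))
    ≡⟨ sumTo-distrib-+ g _ _ ⟩
  sumTo g (λ j → indicator (select j x)) + sumTo g (λ j → length (filterᵇ (select j) xs))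
    ≤⟨ +-mono-≤ (once x) (sumTo-length-filterᵇ g select once xs) ⟩
  suc (length xs) ∎
  where
  open ≤-Reasoning

inWindow : ℕ → ℕ → ℕ → Bool
inWindow r j p = (j * r ≤ᵇ p) ∧ (p <ᵇ j * r + r)

inWindow-true : ∀ r j {p} → j * r ≤ p → p < j * r + r → inWindow r j p ≡ true
inWindow-true r j jr≤p p<jr+r = Equivalence.to T-≡ (Equivalence.from T-∧ (≤⇒≤ᵇ jr≤p , <⇒<ᵇ p<jr+r))

indicator-<ᵇ-split : ∀ p a b →
  indicator (p <ᵇ a) + indicator ((a ≤ᵇ p) ∧ (p <ᵇ a + b)) ≡ indicator (p <ᵇ a + b)
indicator-<ᵇ-split p a b with p <ᵇ a | <ᵇ-reflects-< p a | a ≤ᵇ p | ≤ᵇ-reflects-≤ a p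
... | true  | ofʸ p<a | true  | ofʸ a≤p = contradiction a≤p (<⇒≱ p<a)
... | false | ofⁿ p≮a | false | ofⁿ a≰p = contradiction (≮⇒≥ p≮a) a≰p
... | false | _       | true  | _       = refl
... | true  | ofʸ p<a | false | _       with p <ᵇ a + b | <ᵇ-reflects-< p (a + b)
...   | true  | _         = refl
...   | false | ofⁿ p≮a+b = contradiction (<-≤-trans p<a (m≤m+n a b)) p≮a+b

sumTo-inWindow : ∀ r g p → sumTo g (λ j → indicator (inWindow r j p)) ≡ indicator (p <ᵇ g * r)
sumTo-inWindow r zero    p = refl
sumTo-inWindow r (suc g) p = begin
  sumTo g (λ j → indicator (inWindow r j p)) + indicator (inWindow r g p)
    ≡⟨ cong (_+ indicator (inWindow r g p)) (sumTo-inWindow r g p) ⟩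
  indicator (p <ᵇ g * r) + indicator (inWindow r g p)
    ≡⟨ indicator-<ᵇ-split p (g * r) r ⟩
  indicator (p <ᵇ g * r + r)
    ≡⟨ cong (λ x → indicator (p <ᵇ x)) (+-comm (g * r) r) ⟩
  indicator (p <ᵇ suc g * r)
    ∎
  where
  open ≡-Reasoning

sumTo-inWindow≤1 : ∀ r g p → sumTo g (λ j → indicator (inWindow r j p)) ≤ 1
sumTo-inWindow≤1 r g p = subst (_≤ 1) (sym (sumTo-inWindow r g p)) (indicator≤1 _)

module _ {A B : Set} (_≟_ : DecidableEquality A) (default : B) where

  lookupAssoc : List A → List B → A → B
  lookupAssoc (a ∷ as) (b ∷ bs) x with a ≟ x
  ... | yes _ = b
  ... | no  _ = lookupAssoc as bs x
  lookupAssoc _        _        x = default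

  lookupAssoc-map : ∀ {C : Set} (key : C → A) (f : C → B) xs {x} →
                    (∀ {y} → key y ≡ key x → f y ≡ f x) → x ∈ xs →
                    lookupAssoc (map key xs) (map f xs) (key x) ≡ f x
  lookupAssoc-map key f (y ∷ xs) {x} same x∈ with key y ≟ key x
  ... | yes ky≡kx = same ky≡kx
  lookupAssoc-map key f (y ∷ xs) same (here refl)  | no ky≢kx = contradiction refl ky≢kx
  lookupAssoc-map key f (y ∷ xs) same (there x∈) | no _     = lookupAssoc-map key f xs same x∈

module Decoding {A B : Set} {n} (finite : A ↔ Fin n) (_≟_ : DecidableEquality B)
                (enc : A → B) (enc-injective : Injective _≡_ _≡_ enc) (default : A) where

  elements : List A
  elements = map (Inverse.from finite) (allFin n)

  decode : B → A
  decode = lookupAssoc _≟_ default (map enc elements) (map id elements)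

  decode-enc : ∀ x → decode (enc x) ≡ x
  decode-enc x = lookupAssoc-map _≟_ default enc id elements enc-injective x∈elements
    where
    x∈elements : x ∈ elements
    x∈elements = subst (_∈ elements) (Inverse.inverseʳ finite refl) (∈-map⁺ (Inverse.from finite) (∈-allFin _))

module _ {A : Set} (d : A) (L : ℕ) where

  length-concat-tabulate : ∀ m (h : Fin m → List A) → (∀ i → length (h i) ≡ L) →
                           length (concat (tabulate h)) ≡ m * L
  length-concat-tabulate zero    h _      = refl
  length-concat-tabulate (suc m) h length≡ =
    trans (length-++ (h Fin.zero))
          (cong₂ _+_ (length≡ Fin.zero) (length-concat-tabulate m (h ∘ Fin.suc) (length≡ ∘ Fin.suc)))

  at-concat-tabulate : ∀ m (h : Fin m → List A) → (∀ i → length (h i) ≡ L) → ∀ i {t} → t < L →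
                       at d (concat (tabulate h)) (toℕ i * L + t) ≡ at d (h i) t
  at-concat-tabulate (suc m) h length≡ Fin.zero    t<L =
    at-++ˡ d (h Fin.zero) _ (subst (_ <_) (sym (length≡ Fin.zero)) t<L)
  at-concat-tabulate (suc m) h length≡ (Fin.suc i) {t} t<L = begin
    at d (h Fin.zero ++ rest) (L + toℕ i * L + t)            ≡⟨ cong (at d (h Fin.zero ++ rest)) shift ⟩
    at d (h Fin.zero ++ rest) (length (h Fin.zero) + (toℕ i * L + t)) ≡⟨ at-++ʳ d (h Fin.zero) rest _ ⟩
    at d rest (toℕ i * L + t)                                ≡⟨ at-concat-tabulate m (h ∘ Fin.suc) (length≡ ∘ Fin.suc) i t<L ⟩
    at d (h (Fin.suc i)) t                                   ∎
    where
    open ≡-Reasoning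
    rest : List A
    rest = concat (tabulate (h ∘ Fin.suc))
    shift : L + toℕ i * L + t ≡ length (h Fin.zero) + (toℕ i * L + t)
    shift = trans (+-assoc L (toℕ i * L) t) (cong (_+ (toℕ i * L + t)) (sym (length≡ Fin.zero)))

at-toList : ∀ {A : Set} (d : A) {L} (v : Vec A L) (t : Fin L) → at d (toList v) (toℕ t) ≡ lookup v t
at-toList d (x Vec.∷ v) Fin.zero    = refl
at-toList d (x Vec.∷ v) (Fin.suc t) = at-toList d v t

injective⇒width≢0 : ∀ {A B : Set} {x y : A} → x ≢ y → ∀ {L} (enc : A → Vec B L) → Injective _≡_ _≡_ enc → NonZero L
injective⇒width≢0 {x = x} {y} x≢y {zero} enc inj with enc x in encx | enc y in ency
... | Vec.[] | Vec.[] = contradiction (inj (trans encx (sym ency))) x≢y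
injective⇒width≢0 x≢y {suc _} enc inj = _

module Layout {n} (F : FiniteField n) (enc : FiniteField.Carrier F → Vec Bool ⌈log₂ n ⌉) where
  open FiniteField F

  L : ℕ
  L = ⌈log₂ n ⌉

  encodeAll≡concat : ∀ m α → encodeAll F enc m α ≡ concat (tabulate (λ i → toList (enc (α i))))
  encodeAll≡concat m α = cong concat (map-tabulate id (λ i → toList (enc (α i))))

  length-encodeAll : ∀ m α → length (encodeAll F enc m α) ≡ m * L
  length-encodeAll m α = trans (cong length (encodeAll≡concat m α))
    (length-concat-tabulate false L m (λ i → toList (enc (α i))) (λ i → Vecₚ.length-toList (enc (α i))))

  at-encodeAll : ∀ m α i {t} → t < L → at false (encodeAll F enc m α) (toℕ i * L + t) ≡ at false (toList (enc (α i))) t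
  at-encodeAll m α i t<L = trans (cong (λ bits → at false bits _) (encodeAll≡concat m α))
    (at-concat-tabulate false L m (λ i → toList (enc (α i))) (λ i → Vecₚ.length-toList (enc (α i))) i t<L)

∈-mapMaybe⁺ : ∀ {A B : Set} (f : A → Maybe B) {xs x y} → x ∈ xs → f x ≡ just y → y ∈ mapMaybe f xs
∈-mapMaybe⁺ f {x ∷ xs} (here refl) fx≡y with f x
∈-mapMaybe⁺ f {x ∷ xs} (here refl) refl | just y = here refl
∈-mapMaybe⁺ f {x ∷ xs} (there x∈) fx≡y with f x
... | just _  = there (∈-mapMaybe⁺ f x∈ fx≡y)
... | nothing = ∈-mapMaybe⁺ f x∈ fx≡y

length-concatMap≤ : ∀ {A B : Set} (f : A → List B) {X} → (∀ x → length (f x) ≤ X) →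
                    ∀ xs → length (concatMap f xs) ≤ length xs * X
length-concatMap≤ f bound []       = z≤n
length-concatMap≤ f bound (x ∷ xs) =
  subst (_≤ _) (sym (length-++ (f x))) (+-mono-≤ (bound x) (length-concatMap≤ f bound xs))

module FromCircuit {n} (F : FiniteField n) (σ : FiniteField.Carrier F) (E : Encoding F)
                   (C : Circuit) (computes : Computes F C (proj₁ E) σ) (B r : ℕ) .{{_ : NonZero r}} where

  open FiniteField F using (Carrier; 0F; 0≢1; FFFT)
  open Layout F (proj₁ E)

  enc : Carrier → Vec Bool L
  enc = proj₁ E

  instance
    L≢0 : NonZero L
    L≢0 = injective⇒width≢0 0≢1 enc (proj₂ E)

  m : ℕ
  m = n ∸ 1

  I : ℕ
  I = m * L

  G : List Gate
  G = Circuit.gates C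

  open CircuitGraph I G

  inputBits : (Fin m → Carrier) → List Bool
  inputBits α = encodeAll F enc m α

  val : (Fin m → Carrier) → ℕ → Bool
  val α = at false (wireValues G (inputBits α))

  depth : ℕ → ℕ
  depth = at 0 (wireDepths G (replicate I 0))

  val-follows : ∀ α → Values.Follows I G (val α)
  val-follows α = subst (λ I′ → Values.Follows I′ G (val α)) (length-encodeAll m α) follows
    where
    follows : Values.Follows (length (inputBits α)) G (val α)
    follows rewrite wireValues≡evalWires G (inputBits α) = Values.evalWires-follows G (inputBits α)

  val-absent : ∀ α {w} → I + length G ≤ w → val α w ≡ false
  val-absent α {w} le rewrite wireValues≡evalWires G (inputBits α) =
    Values.evalWires-absent G (inputBits α) (subst (λ I′ → I′ + length G ≤ w) (sym (length-encodeAll m α)) le)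

  val-input : ∀ α {u} → u < I → ∀ i → toℕ i ≡ u / L → val α u ≡ at false (toList (enc (α i))) (u % L)
  val-input α {u} u<I i i≡u/L = begin
    at false (wireValues G (inputBits α)) u
      ≡⟨ cong (λ ws → at false ws u) (wireValues≡evalWires G (inputBits α)) ⟩
    at false (Values.evalWires G (inputBits α)) u
      ≡⟨ Values.evalWires-prefix G (inputBits α) (subst (u <_) (sym (length-encodeAll m α)) u<I) ⟩
    at false (inputBits α) u
      ≡⟨ cong (at false (inputBits α)) u≡ ⟩
    at false (inputBits α) (toℕ i * L + u % L)
      ≡⟨ at-encodeAll m α i (m%n<n u L) ⟩
    at false (toList (enc (α i))) (u % L)
      ∎
    where
    open ≡-Reasoning
    u≡ : u ≡ toℕ i * L + u % L
    u≡ = trans (m≡m%n+[m/n]*n u L) (trans (+-comm (u % L) _) (cong (λ q → q * L + u % L) (sym i≡u/L)))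

  depth-follows : Depths.Follows I G depth
  depth-follows = subst (λ I′ → Depths.Follows I′ G depth) (length-replicate I)
    (subst (λ ds → Depths.Follows (length (replicate I 0)) G (at 0 ds))
           (sym (wireDepths≡evalWires G (replicate I 0))) (Depths.evalWires-follows G (replicate I 0)))

  depth-increases : ∀ {u w} → Edge u w → depth u < depth w
  depth-increases (left {k} k< u<) = subst (depth _ <_) (sym (depth-follows k k<))
    (s≤s (≤-trans (≤-reflexive (sym (readBelow-< 0 depth u<))) (m≤m⊔n _ _)))
  depth-increases (right {k} k< u<) = subst (depth _ <_) (sym (depth-follows k k<))
    (s≤s (≤-trans (≤-reflexive (sym (readBelow-< 0 depth u<))) (m≤n⊔m _ _)))

  -- group j of the Valiant partition: edges whose endpoint depths first differ in a bit of window j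
  select : ℕ → ℕ → ℕ → Bool
  select j u w = inWindow r j (firstDiff B (depth u) (depth w))

  cutCount : ℕ → ℕ
  cutCount j = length (filterᵇ (uncurry (select j)) (edgesFrom I G))

  g : ℕ
  g = B / r

  j₀ : ℕ
  j₀ = proj₁ (belowAverage g cutCount)

  open Cutting (select j₀)

  advice : (Fin m → Carrier) → Vec Bool (length cutEdges)
  advice α = Vec.map (val α ∘ proj₁) (fromList cutEdges)

  adviceBit : Vec Bool (length cutEdges) → ℕ → Bool
  adviceBit adv = lookupAssoc _≟_ false (map proj₁ cutEdges) (toList adv)

  adviceBit-correct : ∀ α {u w} → Edge u w → select j₀ u w ≡ true → adviceBit (advice α) u ≡ val α u
  adviceBit-correct α e cut≡true
    rewrite Vecₚ.toList-map (val α ∘ proj₁) (fromList cutEdges) | Vecₚ.toList∘fromList cutEdges =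
    lookupAssoc-map _≟_ false proj₁ (val α ∘ proj₁) cutEdges (cong (val α)) (edge∈cutEdges e cut≡true)

  absentWire : ℕ
  absentWire = I + length G

  outputWire : Fin m → ℕ → ℕ
  outputWire j t = at absentWire (Circuit.outputs C) (toℕ j * L + t)

  reachOf : ℕ → List ℕ
  reachOf w = reach (suc w) w

  queryWires : Fin m → List ℕ
  queryWires j = concatMap (reachOf ∘ outputWire j) (upTo L)

  toFin? : ℕ → Maybe (Fin m)
  toFin? x with x <? m
  ... | yes x<m = just (fromℕ< x<m)
  ... | no  _   = nothing

  toFin?-< : ∀ {x} (x<m : x < m) → toFin? x ≡ just (fromℕ< x<m)
  toFin?-< {x} x<m with x <? m
  ... | yes _   = refl
  ... | no  x≮m = contradiction x<m x≮m

  queries : Fin m → List (Fin m)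
  queries j = mapMaybe (toFin? ∘ (_/ L)) (queryWires j)

  inputBit : Fin m → List Carrier → ℕ → Bool
  inputBit j vals u = at false (toList (enc (lookupAssoc _≟_ 0F (map toℕ (queries j)) vals (u / L)))) (u % L)

  outputBit : Fin m → Vec Bool (length cutEdges) → List Carrier → Fin L → Bool
  outputBit j adv vals t = evalWithAdvice (inputBit j vals) (adviceBit adv) (suc w) w
    where
    w : ℕ
    w = outputWire j (toℕ t)

  open Decoding (FiniteField.size F) (Vecₚ.≡-dec Bool._≟_) enc (proj₂ E) 0F

  answer : Fin m → Vec Bool (length cutEdges) → List Carrier → Carrier
  answer j adv vals = decode (Vec.tabulate (outputBit j adv vals))

  queryWires-inputs : ∀ j {u} → u ∈ queryWires j → u < I
  queryWires-inputs j u∈ with Any.satisfied (∈-concatMap⁻ (reachOf ∘ outputWire j) {upTo L} u∈)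
  ... | t , u∈reach = reach-inputs (suc (outputWire j t)) (outputWire j t) u∈reach

  reachOf⊆queryWires : ∀ j (t : Fin L) {u} → u ∈ reachOf (outputWire j (toℕ t)) → u ∈ queryWires j
  reachOf⊆queryWires j t u∈ =
    ∈-concatMap⁺ (reachOf ∘ outputWire j) (Any.map (λ { refl → u∈ }) (∈-upTo⁺ (toℕ<n t)))

  module _ (α : Fin m → Carrier) (j : Fin m) where

    inputBit-correct : ∀ {u} → u ∈ queryWires j → inputBit j (map α (queries j)) u ≡ val α u
    inputBit-correct {u} u∈ = begin
      inputBit j (map α (queries j)) u       ≡⟨ cong (λ x → at false (toList (enc x)) (u % L)) α-lookup ⟩
      at false (toList (enc (α i))) (u % L) ≡⟨ val-input α u<I i (toℕ-fromℕ< u/L<m) ⟨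
      val α u                                ∎
      where
      open ≡-Reasoning
      u<I : u < I
      u<I = queryWires-inputs j u∈
      u/L<m : u / L < m
      u/L<m = m<n*o⇒m/o<n u<I
      i : Fin m
      i = fromℕ< u/L<m
      i∈queries : i ∈ queries j
      i∈queries = ∈-mapMaybe⁺ (toFin? ∘ (_/ L)) u∈ (toFin?-< u/L<m)
      α-lookup : lookupAssoc _≟_ 0F (map toℕ (queries j)) (map α (queries j)) (u / L) ≡ α i
      α-lookup = subst (λ q → lookupAssoc _≟_ 0F (map toℕ (queries j)) (map α (queries j)) q ≡ α i)
        (toℕ-fromℕ< u/L<m) (lookupAssoc-map _≟_ 0F toℕ α (queries j) (cong α ∘ toℕ-injective) i∈queries)

    outputBit-correct : ∀ t → outputBit j (advice α) (map α (queries j)) t ≡ lookup (enc (FFFT m σ α j)) t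
    outputBit-correct t = begin
      evalWithAdvice (inputBit j (map α (queries j))) (adviceBit (advice α)) (suc w) w
        ≡⟨ evalWithAdvice-correct (val α) (val-follows α) (val-absent α) _ _ (adviceBit-correct α) (suc w) w ≤-refl
             (All.tabulate (inputBit-correct ∘ reachOf⊆queryWires j t)) ⟩
      val α w
        ≡⟨ at-map absentWire (val α) (val-absent α ≤-refl) (Circuit.outputs C) q ⟨
      at false (run C (inputBits α)) q
        ≡⟨ cong (λ bits → at false bits q) (computes α) ⟩
      at false (encodeAll F enc m (FFFT m σ α)) q
        ≡⟨ at-encodeAll m (FFFT m σ α) j (toℕ<n t) ⟩
      at false (toList (enc (FFFT m σ α j))) (toℕ t)
        ≡⟨ at-toList false (enc (FFFT m σ α j)) t ⟩
      lookup (enc (FFFT m σ α j)) t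
        ∎
      where
      open ≡-Reasoning
      q w : ℕ
      q = toℕ j * L + toℕ t
      w = outputWire j (toℕ t)

    answer-correct : answer j (advice α) (map α (queries j)) ≡ FFFT m σ α j
    answer-correct = begin
      decode (Vec.tabulate (outputBit j (advice α) (map α (queries j))))
        ≡⟨ cong decode (Vecₚ.tabulate-cong outputBit-correct) ⟩
      decode (Vec.tabulate (lookup (enc (FFFT m σ α j))))
        ≡⟨ cong decode (Vecₚ.tabulate∘lookup (enc (FFFT m σ α j))) ⟩
      decode (enc (FFFT m σ α j))
        ≡⟨ decode-enc (FFFT m σ α j) ⟩
      FFFT m σ α j
        ∎
      where
      open ≡-Reasoning

  dataStructure : DataStructure F σ
  dataStructure = record
    { advSize    = length cutEdges
    ; preprocess = advice
    ; queries    = queries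
    ; answer     = answer
    ; correct    = answer-correct
    }

  sumTo-cutCount : sumTo g cutCount ≤ length G * 2
  sumTo-cutCount = subst (sumTo g cutCount ≤_) (length-edgesFrom I G)
    (sumTo-length-filterᵇ g (uncurry ∘ select) (λ e → sumTo-inWindow≤1 r g _) (edgesFrom I G))

  g*length-cutEdges : g * length cutEdges ≤ length G * 2
  g*length-cutEdges = ≤-trans (proj₂ (proj₂ (belowAverage g cutCount))) sumTo-cutCount

  length-cutEdges : length cutEdges ≤ length G * 2
  length-cutEdges = subst (length cutEdges ≤_) (length-edgesFrom I G) (length-filter _ (edgesFrom I G))

  advSize-bound : length cutEdges * B ≤ 4 * r * size C
  advSize-bound = begin
    A * B                       ≤⟨ *-monoʳ-≤ A B≤r+g*r ⟩
    A * (r + g * r)             ≡⟨ solve 3 (λ A r g → A :* (r :+ g :* r) := r :* A :+ r :* (g :* A)) refl A r g ⟩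
    r * A + r * (g * A)         ≤⟨ +-mono-≤ (*-monoʳ-≤ r length-cutEdges) (*-monoʳ-≤ r g*length-cutEdges) ⟩
    r * (s * 2) + r * (s * 2)   ≡⟨ solve 2 (λ r s → r :* (s :* con 2) :+ r :* (s :* con 2) := con 4 :* r :* s) refl r s ⟩
    4 * r * s                   ∎
    where
    open ≤-Reasoning
    open +-*-Solver
    A s : ℕ
    A = length cutEdges
    s = length G
    B≤r+g*r : B ≤ r + g * r
    B≤r+g*r = subst (_≤ r + g * r) (sym (m≡m%n+[m/n]*n B r)) (+-monoˡ-≤ (g * r) (<⇒≤ (m%n<n B r)))

  module _ (r≤B : r ≤ B) (depth<2^B : ∀ w → depth w < 2 ^ B) where

    keep : ℕ → Bool
    keep p = not (inWindow r j₀ p)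

    potential : ℕ → ℕ
    potential w = keptBits B keep (depth w)

    potential-increases : ∀ {u w} → Edge u w → select j₀ u w ≡ false → potential u < potential w
    potential-increases e uncut = keptBits-increasing B keep (depth-increases e) (depth<2^B _) (cong not uncut)

    count-keep : count B keep ≤ B ∸ r
    count-keep = m+n≤o⇒m≤o∸n _ (count+r≤B (j₀ * r) r B keep window≤B λ _ lo hi → cong not (inWindow-true r j₀ lo hi))
      where
      open ≤-Reasoning
      window≤B : j₀ * r + r ≤ B
      window≤B = begin
        j₀ * r + r    ≡⟨ +-comm (j₀ * r) r ⟩
        suc j₀ * r    ≤⟨ *-monoˡ-≤ r (proj₁ (proj₂ (belowAverage g cutCount)) (m≥n⇒m/n>0 r≤B)) ⟩
        g * r         ≤⟨ m/n*n≤m B r ⟩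
        B             ∎

    length-reachOf : ∀ w → length (reachOf w) ≤ 2 ^ 2 ^ (B ∸ r)
    length-reachOf w = ≤-trans (length-reach potential potential-increases (suc w) w)
      (^-monoʳ-≤ 2 (≤-trans (<⇒≤ (keptBits<2^count B keep (depth w))) (^-monoʳ-≤ 2 count-keep)))

    queries-bound : ∀ j → length (queries j) ≤ L * 2 ^ 2 ^ (B ∸ r)
    queries-bound j = ≤-trans (length-mapMaybe _ (queryWires j))
      (subst (λ k → length (queryWires j) ≤ k * _) (length-applyUpTo id L)
             (length-concatMap≤ (reachOf ∘ outputWire j) (length-reachOf ∘ outputWire j) (upTo L)))

[2^2^e]^m≤2^2^[e+m] : ∀ e m → (2 ^ 2 ^ e) ^ m ≤ 2 ^ 2 ^ (e + m)
[2^2^e]^m≤2^2^[e+m] e m = begin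
  (2 ^ 2 ^ e) ^ m      ≡⟨ ^-*-assoc 2 (2 ^ e) m ⟩
  2 ^ (2 ^ e * m)      ≤⟨ ^-monoʳ-≤ 2 (*-monoʳ-≤ (2 ^ e) (<⇒≤ (n<2^n m))) ⟩
  2 ^ (2 ^ e * 2 ^ m)  ≡⟨ cong (2 ^_) (^-distribˡ-+-* 2 e m) ⟨
  2 ^ 2 ^ (e + m)      ∎
  where
  open ≤-Reasoning

-- For ε = a / b, depths get B n = 1 + c₀ + log log n bits and windows r = 1 + c₀ + 2b bits,
-- so that 2 ^ 2 ^ (B n ∸ r) ≤ n ^ (1 / 2b).
module Parameters (c₀ b : ℕ) where

  r : ℕ
  r = suc (c₀ + (b + b))

  B : ℕ → ℕ
  B n = suc (c₀ + ⌊log₂ ⌊log₂ n ⌋ ⌋)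

  threshold : ℕ
  threshold = 2 ^ 2 ^ (b + b)

  c : ℕ
  c = 4 * r * c₀ + (b + b)

  module Large {n} (threshold≤n : threshold ≤ n) where

    k λ′ : ℕ
    k  = ⌊log₂ n ⌋
    λ′ = ⌊log₂ k ⌋

    2^[b+b]≤k : 2 ^ (b + b) ≤ k
    2^[b+b]≤k = subst (_≤ k) (⌊log₂[2^n]⌋≡n _) (⌊log₂⌋-mono-≤ threshold≤n)

    b+b≤λ′ : b + b ≤ λ′
    b+b≤λ′ = subst (_≤ λ′) (⌊log₂[2^n]⌋≡n _) (⌊log₂⌋-mono-≤ 2^[b+b]≤k)

    1≤n : 1 ≤ n
    1≤n = ≤-trans (m^n>0 2 (2 ^ (b + b))) threshold≤n

    2^k≤n : 2 ^ k ≤ n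
    2^k≤n = 2^⌊log₂n⌋≤n n 1≤n

    r≤B : r ≤ B n
    r≤B = s≤s (+-monoʳ-≤ c₀ b+b≤λ′)

    depth-bound : ∀ {d} → d ≤ c₀ * k → d < 2 ^ B n
    depth-bound {d} d≤ = begin-strict
      d                     ≤⟨ d≤ ⟩
      c₀ * k                ≤⟨ *-monoˡ-≤ k (<⇒≤ (n<2^n c₀)) ⟩
      2 ^ c₀ * k            <⟨ *-monoʳ-< (2 ^ c₀) {{m^n≢0 2 c₀}} (n<2^[1+⌊log₂n⌋] k) ⟩
      2 ^ c₀ * 2 ^ suc λ′   ≡⟨ ^-distribˡ-+-* 2 c₀ (suc λ′) ⟨
      2 ^ (c₀ + suc λ′)     ≡⟨ cong (2 ^_) (+-suc c₀ λ′) ⟩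
      2 ^ B n               ∎
      where
      open ≤-Reasoning

    advice-bound : ∀ A {s} → A * B n ≤ 4 * r * s → s ≤ c₀ * n * k → A * λ′ ≤ c * n * k
    advice-bound A {s} A*B≤ s≤ = begin
      A * λ′                ≤⟨ *-monoʳ-≤ A (m≤n+m λ′ (suc c₀)) ⟩
      A * B n               ≤⟨ A*B≤ ⟩
      4 * r * s             ≤⟨ *-monoʳ-≤ (4 * r) s≤ ⟩
      4 * r * (c₀ * n * k)  ≡⟨ solve 4 (λ x c₀ n k → x :* (c₀ :* n :* k) := x :* c₀ :* n :* k) refl (4 * r) c₀ n k ⟩
      4 * r * c₀ * n * k    ≤⟨ *-monoˡ-≤ k (*-monoˡ-≤ n (m≤m+n (4 * r * c₀) (b + b))) ⟩
      c * n * k             ∎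
      where
      open ≤-Reasoning
      open +-*-Solver

    [2^2^[B∸r]]^[b+b]≤n : (2 ^ 2 ^ (B n ∸ r)) ^ (b + b) ≤ n
    [2^2^[B∸r]]^[b+b]≤n = begin
      (2 ^ 2 ^ (B n ∸ r)) ^ (b + b)     ≡⟨ cong (λ e → (2 ^ 2 ^ e) ^ (b + b)) ([m+n]∸[m+o]≡n∸o c₀ λ′ (b + b)) ⟩
      (2 ^ 2 ^ (λ′ ∸ (b + b))) ^ (b + b) ≤⟨ [2^2^e]^m≤2^2^[e+m] (λ′ ∸ (b + b)) (b + b) ⟩
      2 ^ 2 ^ (λ′ ∸ (b + b) + (b + b))  ≡⟨ cong (λ e → 2 ^ 2 ^ e) (m∸n+n≡m b+b≤λ′) ⟩
      2 ^ 2 ^ λ′                        ≤⟨ ^-monoʳ-≤ 2 (2^⌊log₂n⌋≤n k (≤-trans (m^n>0 2 (b + b)) 2^[b+b]≤k)) ⟩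
      2 ^ k                             ≤⟨ 2^k≤n ⟩
      n                                 ∎
      where
      open ≤-Reasoning

    queries-bound : ∀ {len a} → 1 ≤ a → NonZero b → len ≤ ⌈log₂ n ⌉ * 2 ^ 2 ^ (B n ∸ r) → len ^ b ≤ c ^ b * n ^ a
    queries-bound {len} {a} 1≤a b≢0 len≤ = m*m≤n*n⇒m≤n (len ^ b) (c ^ b * n ^ a) (begin
      len ^ b * len ^ b                     ≡⟨ ^-distribˡ-+-* len b b ⟨
      len ^ (b + b)                         ≤⟨ ^-monoˡ-≤ (b + b) len≤ ⟩
      (⌈log₂ n ⌉ * X) ^ (b + b)             ≡⟨ ^-distribʳ-* ⌈log₂ n ⌉ X (b + b) ⟩
      ⌈log₂ n ⌉ ^ (b + b) * X ^ (b + b)     ≤⟨ *-mono-≤ (^-monoˡ-≤ (b + b) (⌈log₂n⌉≤1+⌊log₂n⌋ n)) [2^2^[B∸r]]^[b+b]≤n ⟩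
      suc k ^ (b + b) * n                   ≤⟨ *-monoˡ-≤ n ([1+k]^p≤p^p*2^k (b + b) k {{b+b≢0}}) ⟩
      (b + b) ^ (b + b) * 2 ^ k * n         ≤⟨ *-monoˡ-≤ n (*-mono-≤ (^-monoˡ-≤ (b + b) (m≤n+m (b + b) (4 * r * c₀))) 2^k≤n) ⟩
      c ^ (b + b) * n * n                   ≤⟨ *-monoʳ-≤ (c ^ (b + b) * n) n≤n^a ⟩
      c ^ (b + b) * n * n ^ a               ≤⟨ *-monoˡ-≤ (n ^ a) (*-monoʳ-≤ (c ^ (b + b)) n≤n^a) ⟩
      c ^ (b + b) * n ^ a * n ^ a           ≡⟨ cong (λ x → x * n ^ a * n ^ a) (^-distribˡ-+-* c b b) ⟩
      c ^ b * c ^ b * n ^ a * n ^ a         ≡⟨ solve 2 (λ x y → x :* x :* y :* y := x :* y :* (x :* y)) refl (c ^ b) (n ^ a) ⟩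
      c ^ b * n ^ a * (c ^ b * n ^ a)       ∎)
      where
      open ≤-Reasoning
      open +-*-Solver
      X : ℕ
      X = 2 ^ 2 ^ (B n ∸ r)
      b+b≢0 : NonZero (b + b)
      b+b≢0 = >-nonZero (≤-trans (>-nonZero⁻¹ b {{b≢0}}) (m≤m+n b b))
      n≤n^a : n ≤ n ^ a
      n≤n^a = subst (_≤ n ^ a) (^-identityʳ n) (^-monoʳ-≤ n {{>-nonZero 1≤n}} 1≤a)

corollary10 :
    (F : (s : S) → FiniteField (proj₁ s))
    (σ : (s : S) → FiniteField.Carrier (F s)) →
    (∀ s → FiniteField.HasOrder (F s) (σ s) (proj₁ s ∸ 1)) →
    -- hypothesis: O(n log n)-size, O(log n)-depth circuits for FFFT_{n-1,σ_n}
    Σ ((s : S) → Encoding (F s)) (λ enc → Σ (S → Circuit) λ C →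
      (∀ s → Computes (F s) (C s) (proj₁ (enc s)) (σ s)) ×
      Σ ℕ λ c → Σ ℕ λ N → ∀ s → N ≤ proj₁ s →
        size (C s) ≤ c * proj₁ s * ⌊log₂ proj₁ s ⌋ ×
        DepthAtMost (C s) ((proj₁ s ∸ 1) * ⌈log₂ proj₁ s ⌉) (c * ⌊log₂ proj₁ s ⌋)) →
    -- conclusion: for every ε = a / b > 0 ...
    ∀ (a b : ℕ) → NonZero a → NonZero b →
    Σ ((s : S) → DataStructure (F s) (σ s)) λ D → Σ ℕ λ c → Σ ℕ λ N → ∀ s → N ≤ proj₁ s →
      DataStructure.advSize (D s) * ⌊log₂ ⌊log₂ proj₁ s ⌋ ⌋ ≤ c * proj₁ s * ⌊log₂ proj₁ s ⌋ ×
      (∀ j → length (DataStructure.queries (D s) j) ^ b ≤ c ^ b * proj₁ s ^ a)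
corollary10 F σ _ (enc , C , computes , c₀ , N₀ , circuit-bounds) a b a≢0 b≢0 =
  dataStructure , c , N₀ + threshold , bounds
  where
  open Parameters c₀ b
  module Construction (s : S) = FromCircuit (F s) (σ s) (enc s) (C s) (computes s) (B (proj₁ s)) r ⦃ nonZero ⦄
  open Construction using (dataStructure)

  bounds : ∀ s → N₀ + threshold ≤ proj₁ s →
    DataStructure.advSize (dataStructure s) * ⌊log₂ ⌊log₂ proj₁ s ⌋ ⌋ ≤ c * proj₁ s * ⌊log₂ proj₁ s ⌋ ×
    (∀ j → length (DataStructure.queries (dataStructure s) j) ^ b ≤ c ^ b * proj₁ s ^ a)
  bounds s N≤n with circuit-bounds s (≤-trans (m≤m+n N₀ threshold) N≤n)
  ... | size≤ , depth≤ =
    advice-bound (DataStructure.advSize (dataStructure s)) (Construction.advSize-bound s) size≤ ,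
    queries-bound (>-nonZero⁻¹ a {{a≢0}}) b≢0 ∘ Construction.queries-bound s r≤B (depth-bound ∘ depth≤)
    where
    open Large (≤-trans (m≤n+m threshold N₀) N≤n)
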